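{- Let $\Delta:\mathcal{A}\to\mathcal{A}\otimes\mathcal{A}$ be the linear map with $\Delta(|)=|\otimes|$ whose restriction to $\mathcal{A}^+$ is the unique tridendriform algebra morphism $\mathcal{A}^+\to\mathcal{A}\overline{\otimes}\mathcal{A}$ with $\Delta(Y)=Y\otimes|+|\otimes Y$, and for $x\in\mathcal{A}^+$ set $\tilde{\Delta}(x)=\Delta(x)-|\otimes x-x\otimes|$. Writing $1=|$, for all $t,s\in\mathcal{A}^+$: $\tilde{\Delta}(t\cdot s)=\tilde{\Delta}(t)\cdot\tilde{\Delta}(s)+(1\otimes t)\cdot\tilde{\Delta}(s)+\tilde{\Delta}(t)\cdot(1\otimes s)$, $\tilde{\Delta}(t\prec s)=s\otimes t+(1\otimes t)\prec\tilde{\Delta}(s)+\tilde{\Delta}(t)\prec(1\otimes s)+\tilde{\Delta}(t)*(s\otimes 1)+\tilde{\Delta}(t)\prec\tilde{\Delta}(s)$, $\tilde{\Delta}(t\succ s)=t\otimes s+(1\otimes t)\succ\tilde{\Delta}(s)+(t\otimes 1)*\tilde{\Delta}(s)+\tilde{\Delta}(t)\succ(1\otimes s)+\tilde{\Delta}(t)\succ\tilde{\Delta}(s)$.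
   Context: Tridendriform algebra: vector space with bilinear $\prec,\cdot,\succ$ such that, with $*=\prec+\cdot+\succ$: $(a\prec b)\prec c=a\prec(b*c)$, $(a\succ b)\prec c=a\succ(b\prec c)$, $(a*b)\succ c=a\succ(b\succ c)$, $(a\succ b)\cdot c=a\succ(b\cdot c)$, $(a\prec b)\cdot c=a\cdot(b\succ c)$, $(a\cdot b)\prec c=a\cdot(b\prec c)$, $(a\cdot b)\cdot c=a\cdot(b\cdot c)$. The free tridendriform algebra: a reduced tree is a planar rooted tree whose internal vertices all have at least two children; $|$ is the tree with one leaf and no internal vertex. $T_n$ = reduced trees with $n+1$ leaves, $\mathcal{A}_n=\mathbb{K}T_n$, $\mathcal{A}=\bigoplus_{n\ge0}\mathcal{A}_n$, $\mathcal{A}^+=\bigoplus_{n\ge1}\mathcal{A}_n$. For trees $x^{(0)},\dots,x^{(k)}$ ($k\ge1$), $x^{(0)}\vee\cdots\vee x^{(k)}$ is the tree obtained by grafting them from left to right on a new root (extended multilinearly); every tree $\neq|$ has a unique such expression; $Y=|\vee|$. For $x=x^{(0)}\vee\cdots\vee x^{(k)}$, $y=y^{(0)}\vee\cdots\vee y^{(l)}$ define recursively $x\prec y=x^{(0)}\vee\cdots\vee x^{(k-1)}\vee(x^{(k)}*y)$, $x\cdot y=x^{(0)}\vee\cdots\vee x^{(k-1)}\vee(x^{(k)}*y^{(0)})\vee y^{(1)}\vee\cdots\vee y^{(l)}$, $x\succ y=(x*y^{(0)})\vee y^{(1)}\vee\cdots\vee y^{(l)}$, with $*=\prec+\cdot+\succ$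 and $|$ a unit for $*$. Then $\mathcal{A}^+$ is the free tridendriform algebra on $Y$. Augmentation conventions: for $a\in\mathcal{A}^+$, $|\prec a=0$, $a\prec|=a$, $|\succ a=a$, $a\succ|=0$, $|\cdot a=a\cdot|=0$. Structure on $\mathcal{A}\otimes\mathcal{A}$: $(a\otimes b)*(c\otimes d)=(a*c)\otimes(b*d)$, and for $\ltimes\in\{\prec,\cdot,\succ\}$ and trees $a,b,c,d$ with $(a\otimes b),(c\otimes d)$ not both $|\otimes|$: $(a\otimes b)\ltimes(c\otimes d)=(a*c)\otimes(b\ltimes d)$ if $b\ne|$ or $d\ne|$, and $(a\otimes|)\ltimes(c\otimes|)=(a\ltimes c)\otimes|$; this makes $\mathcal{A}\overline{\otimes}\mathcal{A}=\mathcal{A}\otimes\mathcal{A}\ominus\mathbb{K}(|\otimes|)$ a tridendriform algebra. -}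

module Defs where

open import Level using (Level; _⊔_; suc)
open import Algebra.Bundles using (CommutativeRing)
open import Data.Bool using (Bool; true; false; _∧_; if_then_else_)
open import Data.List using (List; []; _∷_; _++_; map; concatMap; foldr)
open import Data.Product using (_×_; _,_; Σ)
open import Relation.Nullary using (¬_)

record Field (c ℓ : Level) : Set (suc (c ⊔ ℓ)) where
  field
    commutativeRing : CommutativeRing c ℓ
  open CommutativeRing commutativeRing public
  field
    0≉1     : ¬ (0# ≈ 1#)
    inverse : ∀ x → ¬ (x ≈ 0#) → Σ Carrier (λ y → x * y ≈ 1#)

-- Reduced planar rooted trees.
-- leaf        = the tree | (one leaf, no internal vertex)
-- node a ms b = a ∨ m₁ ∨ … ∨ mⱼ ∨ b   (children a, ms, b from left to
--               right; so every internal vertex has ≥ 2 children).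

data Tree : Set where
  leaf : Tree
  node : Tree → List Tree → Tree → Tree

Y : Tree
Y = node leaf [] leaf

mutual
  eqT : Tree → Tree → Bool
  eqT leaf leaf = true
  eqT leaf (node _ _ _) = false
  eqT (node _ _ _) leaf = false
  eqT (node a ms b) (node c ns d) = eqT a c ∧ eqTs ms ns ∧ eqT b d

  eqTs : List Tree → List Tree → Bool
  eqTs [] [] = true
  eqTs [] (_ ∷ _) = false
  eqTs (_ ∷ _) [] = false
  eqTs (x ∷ xs) (y ∷ ys) = eqT x y ∧ eqTs xs ys

eqT² : Tree × Tree → Tree × Tree → Bool
eqT² (a , b) (c , d) = eqT a c ∧ eqT b d

isLeaf : Tree → Bool
isLeaf leaf = true
isLeaf (node _ _ _) = false

-- The tridendriform products on basis trees, with values formal sums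
-- (lists) of trees, every term having coefficient 1.  These are the
-- recursive definitions of the paper, with | a unit for *, and the
-- augmentation conventions  | ≺ a = 0, a ≺ | = a, | ≻ a = a, a ≻ | = 0,
-- | · a = a · | = 0  (the value on (|,|) of ≺,·,≻ is never used with a
-- nonzero coefficient below and is set to 0).

mutual
  starT : Tree → Tree → List Tree
  starT leaf y = y ∷ []
  starT x@(node _ _ _) leaf = x ∷ []
  starT x@(node _ _ _) y@(node _ _ _) = precT x y ++ (dotT x y ++ succT x y)

  -- (x₀ ∨ … ∨ xₖ) ≺ y = x₀ ∨ … ∨ xₖ₋₁ ∨ (xₖ * y)
  precT : Tree → Tree → List Tree
  precT leaf y = []
  precT x@(node _ _ _) leaf = x ∷ []
  precT (node a ms b) y@(node _ _ _) = map (λ z → node a ms z) (starT b y)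

  -- x · y = x₀ ∨ … ∨ xₖ₋₁ ∨ (xₖ * y₀) ∨ y₁ ∨ … ∨ yₗ
  dotT : Tree → Tree → List Tree
  dotT leaf y = []
  dotT (node _ _ _) leaf = []
  dotT (node a ms b) (node c ns d) = map (λ z → node a (ms ++ (z ∷ ns)) d) (starT b c)

  -- x ≻ y = (x * y₀) ∨ y₁ ∨ … ∨ yₗ
  succT : Tree → Tree → List Tree
  succT leaf y = y ∷ []
  succT (node _ _ _) leaf = []
  succT x@(node _ _ _) (node c ns d) = map (λ z → node z ns d) (starT x c)

cart : List Tree → List Tree → List (Tree × Tree)
cart xs ys = concatMap (λ x → map (λ y → (x , y)) ys) xs

star² : Tree × Tree → Tree × Tree → List (Tree × Tree)
star² (a , b) (c , d) = cart (starT a c) (starT b d)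

lift² : (Tree → Tree → List Tree) → Tree × Tree → Tree × Tree → List (Tree × Tree)
lift² op (a , b) (c , d) =
  if isLeaf b ∧ isLeaf d
  then map (λ p → (p , leaf)) (op a c)
  else cart (starT a c) (op b d)

prec² dot² succ² : Tree × Tree → Tree × Tree → List (Tree × Tree)
prec² = lift² precT
dot²  = lift² dotT
succ² = lift² succT

module Lin {c ℓ} (R : CommutativeRing c ℓ) where
  open CommutativeRing R

  LC : Set → Set c
  LC B = List (Carrier × B)

  coeff : {B : Set} → (B → B → Bool) → B → LC B → Carrier
  coeff eq b = foldr (λ { (k , x) r → if eq b x then k + r else r }) 0#

  𝒜 : Set c
  𝒜 = LC Tree

  𝒜⊗𝒜 : Set c
  𝒜⊗𝒜 = LC (Tree × Tree)

  _≈𝒜_ : 𝒜 → 𝒜 → Set ℓ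
  u ≈𝒜 v = ∀ b → coeff eqT b u ≈ coeff eqT b v

  _≈⊗_ : 𝒜⊗𝒜 → 𝒜⊗𝒜 → Set ℓ
  u ≈⊗ v = ∀ b → coeff eqT² b u ≈ coeff eqT² b v

  In𝒜⁺ : 𝒜 → Set ℓ
  In𝒜⁺ u = coeff eqT leaf u ≈ 0#

  bilin : {A B C : Set} → (A → B → List C) → LC A → LC B → LC C
  bilin f u v =
    concatMap (λ { (k , a) → concatMap (λ { (m , b) → map (λ x → (k * m , x)) (f a b) }) v }) u

  _⊕_ : {B : Set} → LC B → LC B → LC B
  u ⊕ v = u ++ v

  ⊖_ : {B : Set} → LC B → LC B
  ⊖ u = map (λ { (k , x) → (- k , x) }) u

  ⟨_⟩ : {B : Set} → B → LC B
  ⟨ b ⟩ = (1# , b) ∷ []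

  _≺_ _·_ _≻_ _✱_ : 𝒜 → 𝒜 → 𝒜
  _≺_ = bilin precT
  _·_ = bilin dotT
  _≻_ = bilin succT
  _✱_ = bilin starT

  _≺⊗_ _·⊗_ _≻⊗_ _✱⊗_ : 𝒜⊗𝒜 → 𝒜⊗𝒜 → 𝒜⊗𝒜
  _≺⊗_ = bilin prec²
  _·⊗_ = bilin dot²
  _≻⊗_ = bilin succ²
  _✱⊗_ = bilin star²

  _⊗_ : 𝒜 → 𝒜 → 𝒜⊗𝒜
  _⊗_ = bilin (λ a b → (a , b) ∷ [])

  𝟙 : 𝒜
  𝟙 = ⟨ leaf ⟩

  linExt : (Tree → 𝒜⊗𝒜) → 𝒜 → 𝒜⊗𝒜
  linExt Δ u = concatMap (λ { (k , x) → map (λ { (m , p) → (k * m , p) }) (Δ x) }) u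

  -- Δ is the linear map 𝒜 → 𝒜 ⊗ 𝒜 with Δ(|) = | ⊗ | whose restriction
  -- to 𝒜⁺ is a tridendriform algebra morphism 𝒜⁺ → 𝒜 ⊗̄ 𝒜 with
  -- Δ(Y) = Y ⊗ | + | ⊗ Y.  (By freeness of 𝒜⁺ on Y such a Δ exists and is
  -- unique; we record the defining properties.)
  record IsCoproduct (Δ : Tree → 𝒜⊗𝒜) : Set (c ⊔ ℓ) where
    field
      Δ-unit  : Δ leaf ≈⊗ ⟨ (leaf , leaf) ⟩
      -- values on 𝒜⁺ lie in 𝒜 ⊗̄ 𝒜 = 𝒜 ⊗ 𝒜 ⊖ K(| ⊗ |)
      Δ-⊗̄     : ∀ u → In𝒜⁺ u → coeff eqT² (leaf , leaf) (linExt Δ u) ≈ 0#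
      Δ-≺     : ∀ u v → In𝒜⁺ u → In𝒜⁺ v → linExt Δ (u ≺ v) ≈⊗ (linExt Δ u ≺⊗ linExt Δ v)
      Δ-·     : ∀ u v → In𝒜⁺ u → In𝒜⁺ v → linExt Δ (u · v) ≈⊗ (linExt Δ u ·⊗ linExt Δ v)
      Δ-≻     : ∀ u v → In𝒜⁺ u → In𝒜⁺ v → linExt Δ (u ≻ v) ≈⊗ (linExt Δ u ≻⊗ linExt Δ v)
      Δ-Y     : Δ Y ≈⊗ (⟨ (Y , leaf) ⟩ ⊕ ⟨ (leaf , Y) ⟩)

  Δ̃ : (Tree → 𝒜⊗𝒜) → 𝒜 → 𝒜⊗𝒜
  Δ̃ Δ x = linExt Δ x ⊕ ((⊖ (𝟙 ⊗ x)) ⊕ (⊖ (x ⊗ 𝟙)))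

-- Pairing formal combinations with arbitrary functionals on the basis identifies two combinations
-- exactly when their coefficients agree, and in this form sums can be rearranged freely.
-- Write Δ x = 1 ⊗ x + x ⊗ 1 + Δ̃ x.  For ⋉ ∈ {≺, ·, ≻}, expanding Δ (t ⋉ s) = Δ t ⋉ Δ s gives nine
-- products: (1 ⊗ t) ⋉ (1 ⊗ s) and (t ⊗ 1) ⋉ (s ⊗ 1) cancel the correction terms of Δ̃ (t ⋉ s), the
-- products of two pure tensors with a factor 1 reduce by the augmentation rules | ≺ a = 0,
-- a ≺ | = a, …, and the products of t ⊗ 1 or s ⊗ 1 with Δ̃ only see the part of Δ̃ in 𝒜 ⊗ 𝒜⁺.
-- In fact Δ̃ x ∈ 𝒜 ⊗ 𝒜⁺ for x ∈ 𝒜⁺: the 𝒜 ⊗ |-component of Δ x is x ⊗ | for every tree x ≠ |,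
-- by induction, since such a tree is a ≺-, ·- or ≻-product of smaller ones and the projection
-- onto 𝒜 ⊗ | is multiplicative.

module Submission where

open import Defs
open import Algebra.Bundles using (CommutativeRing; CommutativeMonoid)
open import Data.Bool using (Bool; true; false; if_then_else_)
open import Data.Bool.Properties using (∧-conicalˡ; ∧-conicalʳ)
open import Data.List using (List; []; _∷_; _++_; map; concatMap; length)
open import Data.List.Properties using (++-assoc; ++-identityʳ)
open import Data.List.Relation.Unary.All using (All; []; _∷_; universal)
open import Data.List.Relation.Unary.All.Properties using (map⁺)
open import Data.Nat using (suc; _≤_; z≤n; s≤s)
open import Data.Nat.Properties using (≤-refl; ≤-trans; m≤n⇒m≤1+n)
open import Data.Product using (_×_; _,_)
open import Level using (Level; _⊔_)
open import Relation.Binary.PropositionalEquality as ≡ using (_≡_)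
import Algebra.Solver.CommutativeMonoid as CommutativeMonoidSolver

mutual
  eqT⇒≡ : ∀ {x y} → eqT x y ≡ true → x ≡ y
  eqT⇒≡ {leaf} {leaf} _ = ≡.refl
  eqT⇒≡ {leaf} {node _ _ _} ()
  eqT⇒≡ {node _ _ _} {leaf} ()
  eqT⇒≡ {node a ms b} {node c ns d} e
    with eqT⇒≡ {a} {c} (∧-conicalˡ (eqT a c) _ e)
       | eqTs⇒≡ {ms} {ns} (∧-conicalˡ (eqTs ms ns) _ (∧-conicalʳ (eqT a c) _ e))
       | eqT⇒≡ {b} {d} (∧-conicalʳ (eqTs ms ns) _ (∧-conicalʳ (eqT a c) _ e))
  ... | ≡.refl | ≡.refl | ≡.refl = ≡.refl

  eqTs⇒≡ : ∀ {xs ys} → eqTs xs ys ≡ true → xs ≡ ys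
  eqTs⇒≡ {[]} {[]} _ = ≡.refl
  eqTs⇒≡ {[]} {_ ∷ _} ()
  eqTs⇒≡ {_ ∷ _} {[]} ()
  eqTs⇒≡ {x ∷ xs} {y ∷ ys} e
    with eqT⇒≡ {x} {y} (∧-conicalˡ (eqT x y) _ e) | eqTs⇒≡ {xs} {ys} (∧-conicalʳ (eqT x y) _ e)
  ... | ≡.refl | ≡.refl = ≡.refl

mutual
  eqT-refl : ∀ x → eqT x x ≡ true
  eqT-refl leaf = ≡.refl
  eqT-refl (node a ms b) rewrite eqT-refl a | eqTs-refl ms | eqT-refl b = ≡.refl

  eqTs-refl : ∀ xs → eqTs xs xs ≡ true
  eqTs-refl [] = ≡.refl
  eqTs-refl (x ∷ xs) rewrite eqT-refl x | eqTs-refl xs = ≡.refl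

eqT²⇒≡ : ∀ {p q} → eqT² p q ≡ true → p ≡ q
eqT²⇒≡ {a , b} {c , d} e
  with eqT⇒≡ {a} {c} (∧-conicalˡ (eqT a c) _ e) | eqT⇒≡ {b} {d} (∧-conicalʳ (eqT a c) _ e)
... | ≡.refl | ≡.refl = ≡.refl

eqT²-refl : ∀ p → eqT² p p ≡ true
eqT²-refl (a , b) rewrite eqT-refl a | eqT-refl b = ≡.refl

IsNode : Tree → Set
IsNode x = isLeaf x ≡ false

record RespectsAugmentation (op : Tree → Tree → List Tree) : Set where
  field
    unit-unit : All (_≡ leaf) (op leaf leaf)
    nodeˡ     : ∀ a ms b y → All IsNode (op (node a ms b) y)
    nodeʳ     : ∀ x a ms b → All IsNode (op x (node a ms b))

all-node : {A : Set} (f : A → Tree) → (∀ z → IsNode (f z)) → ∀ zs → All IsNode (map f zs)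
all-node f f-node zs = map⁺ (universal f-node zs)

≺-respectsAugmentation : RespectsAugmentation precT
≺-respectsAugmentation = record { unit-unit = [] ; nodeˡ = nodeˡ ; nodeʳ = nodeʳ }
  where
  nodeˡ : ∀ a ms b y → All IsNode (precT (node a ms b) y)
  nodeˡ a ms b leaf = ≡.refl ∷ []
  nodeˡ a ms b (node _ _ _) = all-node (node a ms) (λ _ → ≡.refl) _
  nodeʳ : ∀ x a ms b → All IsNode (precT x (node a ms b))
  nodeʳ leaf _ _ _ = []
  nodeʳ (node a ms b) _ _ _ = all-node (node a ms) (λ _ → ≡.refl) _

·-respectsAugmentation : RespectsAugmentation dotT
·-respectsAugmentation = record { unit-unit = [] ; nodeˡ = nodeˡ ; nodeʳ = nodeʳ }
  where
  nodeˡ : ∀ a ms b y → All IsNode (dotT (node a ms b) y)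
  nodeˡ a ms b leaf = []
  nodeˡ a ms b (node _ ns d) = all-node (λ z → node a (ms ++ (z ∷ ns)) d) (λ _ → ≡.refl) _
  nodeʳ : ∀ x a ms b → All IsNode (dotT x (node a ms b))
  nodeʳ leaf _ _ _ = []
  nodeʳ (node a ms _) _ ns d = all-node (λ z → node a (ms ++ (z ∷ ns)) d) (λ _ → ≡.refl) _

≻-respectsAugmentation : RespectsAugmentation succT
≻-respectsAugmentation = record { unit-unit = ≡.refl ∷ [] ; nodeˡ = nodeˡ ; nodeʳ = nodeʳ }
  where
  nodeˡ : ∀ a ms b y → All IsNode (succT (node a ms b) y)
  nodeˡ a ms b leaf = []
  nodeˡ a ms b (node _ ns d) = all-node (λ z → node z ns d) (λ _ → ≡.refl) _
  nodeʳ : ∀ x a ms b → All IsNode (succT x (node a ms b))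
  nodeʳ leaf _ _ _ = ≡.refl ∷ []
  nodeʳ (node _ _ _) _ ns d = all-node (λ z → node z ns d) (λ _ → ≡.refl) _

module Evaluation {c ℓ} (R : CommutativeRing c ℓ) where
  open CommutativeRing R
  open Lin R
  open import Algebra.Properties.Ring ring using (-‿distribʳ-*; -‿distribˡ-*)
  open import Algebra.Properties.AbelianGroup +-abelianGroup
    using (⁻¹-∙-comm; ε⁻¹≈ε; x∙y⁻¹≈ε⇒x≈y; x≈y⇒x∙y⁻¹≈ε; xyx⁻¹≈y)
  open import Algebra.Properties.CommutativeSemigroup +-commutativeSemigroup
    using (interchange) renaming (x∙yz≈y∙xz to x∙yz≈y∙xz₊)
  open import Algebra.Properties.CommutativeSemigroup *-commutativeSemigroup
    using (x∙yz≈y∙xz)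
  open import Relation.Binary.Reasoning.Setoid setoid

  sumBy : {a : Level} {A : Set a} → (A → Carrier) → List A → Carrier
  sumBy h [] = 0#
  sumBy h (x ∷ xs) = h x + sumBy h xs

  module _ {a : Level} {A : Set a} where

    sumBy-cong : {h h′ : A → Carrier} (xs : List A) → (∀ x → h x ≈ h′ x) → sumBy h xs ≈ sumBy h′ xs
    sumBy-cong [] _ = refl
    sumBy-cong (x ∷ xs) e = +-cong (e x) (sumBy-cong xs e)

    sumBy-++ : (h : A → Carrier) (xs ys : List A) → sumBy h (xs ++ ys) ≈ sumBy h xs + sumBy h ys
    sumBy-++ h [] ys = sym (+-identityˡ _)
    sumBy-++ h (x ∷ xs) ys = trans (+-congˡ (sumBy-++ h xs ys)) (sym (+-assoc _ _ _))

    sumBy-+ : (h h′ : A → Carrier) (xs : List A) →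
      sumBy (λ x → h x + h′ x) xs ≈ sumBy h xs + sumBy h′ xs
    sumBy-+ h h′ [] = sym (+-identityˡ _)
    sumBy-+ h h′ (x ∷ xs) = trans (+-congˡ (sumBy-+ h h′ xs)) (interchange _ _ _ _)

    sumBy-*ˡ : (k : Carrier) (h : A → Carrier) (xs : List A) → sumBy (λ x → k * h x) xs ≈ k * sumBy h xs
    sumBy-*ˡ k h [] = sym (zeroʳ k)
    sumBy-*ˡ k h (x ∷ xs) = trans (+-congˡ (sumBy-*ˡ k h xs)) (sym (distribˡ k _ _))

    sumBy-neg : (h : A → Carrier) (xs : List A) → sumBy (λ x → - h x) xs ≈ - sumBy h xs
    sumBy-neg h [] = sym ε⁻¹≈ε
    sumBy-neg h (x ∷ xs) = trans (+-congˡ (sumBy-neg h xs)) (⁻¹-∙-comm _ _)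

    sumBy-0 : (xs : List A) → sumBy (λ _ → 0#) xs ≈ 0#
    sumBy-0 [] = refl
    sumBy-0 (x ∷ xs) = trans (+-identityˡ _) (sumBy-0 xs)

  sumBy-map : {a b : Level} {A : Set a} {B : Set b} (h : B → Carrier) (f : A → B) (xs : List A) →
    sumBy h (map f xs) ≈ sumBy (λ x → h (f x)) xs
  sumBy-map h f [] = refl
  sumBy-map h f (x ∷ xs) = +-congˡ (sumBy-map h f xs)

  sumBy-concatMap : {a b : Level} {A : Set a} {B : Set b} (h : B → Carrier) (f : A → List B) (xs : List A) →
    sumBy h (concatMap f xs) ≈ sumBy (λ x → sumBy h (f x)) xs
  sumBy-concatMap h f [] = refl
  sumBy-concatMap h f (x ∷ xs) =
    trans (sumBy-++ h (f x) (concatMap f xs)) (+-congˡ (sumBy-concatMap h f xs))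

  eval : {B : Set} → (B → Carrier) → LC B → Carrier
  eval g = sumBy (λ (k , x) → k * g x)

  module _ {B : Set} where

    eval-cong : {g g′ : B → Carrier} (u : LC B) → (∀ x → g x ≈ g′ x) → eval g u ≈ eval g′ u
    eval-cong u e = sumBy-cong u (λ (k , x) → *-congˡ (e x))

    eval-+ : (g g′ : B → Carrier) (u : LC B) → eval (λ x → g x + g′ x) u ≈ eval g u + eval g′ u
    eval-+ g g′ u = trans (sumBy-cong u (λ (k , _) → distribˡ k _ _)) (sumBy-+ _ _ u)

    eval-*ˡ : (k : Carrier) (g : B → Carrier) (u : LC B) → eval (λ x → k * g x) u ≈ k * eval g u
    eval-*ˡ k g u = trans (sumBy-cong u (λ (m , _) → x∙yz≈y∙xz m k _)) (sumBy-*ˡ k _ u)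

    eval-0 : (u : LC B) → eval (λ _ → 0#) u ≈ 0#
    eval-0 u = trans (sumBy-cong u (λ (k , _) → zeroʳ k)) (sumBy-0 u)

    eval-neg : (g : B → Carrier) (u : LC B) → eval (λ x → - g x) u ≈ - eval g u
    eval-neg g u = trans (sumBy-cong u (λ (k , x) → sym (-‿distribʳ-* k (g x)))) (sumBy-neg _ u)

    eval-⊕ : (g : B → Carrier) (u v : LC B) → eval g (u ⊕ v) ≈ eval g u + eval g v
    eval-⊕ g = sumBy-++ _

    eval-⊖ : (g : B → Carrier) (u : LC B) → eval g (⊖ u) ≈ - eval g u
    eval-⊖ g u = begin
      eval g (⊖ u)                 ≈⟨ sumBy-map _ _ u ⟩
      sumBy (λ (k , x) → - k * g x) u ≈⟨ sumBy-cong u (λ (k , x) → sym (-‿distribˡ-* k (g x))) ⟩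
      sumBy (λ (k , x) → - (k * g x)) u ≈⟨ sumBy-neg _ u ⟩
      - eval g u                   ∎

    eval-⊕₃ : (g : B → Carrier) (u v w : LC B) → eval g (u ⊕ (v ⊕ w)) ≈ eval g u + (eval g v + eval g w)
    eval-⊕₃ g u v w = trans (eval-⊕ g u (v ⊕ w)) (+-congˡ (eval-⊕ g v w))

    eval-⟨⟩ : (g : B → Carrier) (x : B) → eval g ⟨ x ⟩ ≈ g x
    eval-⟨⟩ g x = trans (+-identityʳ _) (*-identityˡ _)

  eval-bilin : {A B C : Set} (f : A → B → List C) (g : C → Carrier) (u : LC A) (v : LC B) →
    eval g (bilin f u v) ≈ eval (λ a → eval (λ b → sumBy g (f a b)) v) u
  eval-bilin f g u v =
    trans (sumBy-concatMap _ _ u) (sumBy-cong u (λ (k , a) →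
      trans (sumBy-concatMap _ _ v)
        (trans (sumBy-cong v (λ (m , b) → scaled k m (f a b))) (sumBy-*ˡ k _ v))))
    where
    scaled : ∀ k m xs → eval g (map (λ x → (k * m , x)) xs) ≈ k * (m * sumBy g xs)
    scaled k m xs = begin
      eval g (map (λ x → (k * m , x)) xs) ≈⟨ sumBy-map _ _ xs ⟩
      sumBy (λ x → k * m * g x) xs        ≈⟨ sumBy-*ˡ (k * m) g xs ⟩
      k * m * sumBy g xs                  ≈⟨ *-assoc k m _ ⟩
      k * (m * sumBy g xs)                ∎

  eval-linExt : (Δ : Tree → 𝒜⊗𝒜) (g : Tree × Tree → Carrier) (u : 𝒜) →
    eval g (linExt Δ u) ≈ eval (λ x → eval g (Δ x)) u
  eval-linExt Δ g u =
    trans (sumBy-concatMap _ _ u) (sumBy-cong u (λ (k , x) → begin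
      eval g (map (λ (m , p) → (k * m , p)) (Δ x)) ≈⟨ sumBy-map _ _ (Δ x) ⟩
      sumBy (λ (m , p) → k * m * g p) (Δ x)        ≈⟨ sumBy-cong (Δ x) (λ (m , p) → *-assoc k m (g p)) ⟩
      sumBy (λ (m , p) → k * (m * g p)) (Δ x)      ≈⟨ sumBy-*ˡ k _ (Δ x) ⟩
      k * eval g (Δ x)                             ∎))

  -- Coefficientwise equality in disguise (coeffs⇒≐, ≐⇒coeffs); as a record, its sides can be inferred.
  infix 4 _≐_
  record _≐_ {B : Set} (u v : LC B) : Set (c ⊔ ℓ) where
    field
      ≐-eval : ∀ g → eval g u ≈ eval g v
  open _≐_ public

  module Coefficients {B : Set} (eq : B → B → Bool)
      (eq⇒≡ : ∀ {x y} → eq x y ≡ true → x ≡ y) (eq-refl : ∀ x → eq x x ≡ true) where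

    δ : B → B → Carrier
    δ b x = if eq b x then 1# else 0#

    coeff≈eval-δ : ∀ b u → coeff eq b u ≈ eval (δ b) u
    coeff≈eval-δ b [] = refl
    coeff≈eval-δ b ((k , x) ∷ u) with eq b x
    ... | true = +-cong (sym (*-identityʳ k)) (coeff≈eval-δ b u)
    ... | false = trans (sym (+-identityˡ _)) (+-cong (sym (zeroʳ k)) (coeff≈eval-δ b u))

    without : B → LC B → LC B
    without x [] = []
    without x ((k , y) ∷ w) = if eq x y then without x w else (k , y) ∷ without x w

    length-without : ∀ x w → length (without x w) ≤ length w
    length-without x [] = z≤n
    length-without x ((k , y) ∷ w) with eq x y
    ... | true = m≤n⇒m≤1+n (length-without x w)
    ... | false = s≤s (length-without x w)

    length-without-head : ∀ x k w → length (without x ((k , x) ∷ w)) ≤ length w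
    length-without-head x k w rewrite eq-refl x = length-without x w

    eval-without : ∀ g x w → eval g w ≈ coeff eq x w * g x + eval g (without x w)
    eval-without g x [] = sym (trans (+-identityʳ _) (zeroˡ _))
    eval-without g x ((k , y) ∷ w) with eq x y in e
    ... | true with eq⇒≡ e
    ...   | ≡.refl = begin
      k * g x + eval g w                                 ≈⟨ +-congˡ (eval-without g x w) ⟩
      k * g x + (coeff eq x w * g x + eval g (without x w)) ≈⟨ +-assoc _ _ _ ⟨
      k * g x + coeff eq x w * g x + eval g (without x w)   ≈⟨ +-congʳ (distribʳ (g x) k _) ⟨
      (k + coeff eq x w) * g x + eval g (without x w)       ∎
    eval-without g x ((k , y) ∷ w) | false =
      trans (+-congˡ (eval-without g x w)) (x∙yz≈y∙xz₊ _ _ _)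

    coeff-without-self : ∀ x w → coeff eq x (without x w) ≈ 0#
    coeff-without-self x [] = refl
    coeff-without-self x ((k , y) ∷ w) with eq x y in e
    ... | true = coeff-without-self x w
    ... | false rewrite e = coeff-without-self x w

    coeff-without-other : ∀ b x w → eq b x ≡ false → coeff eq b (without x w) ≈ coeff eq b w
    coeff-without-other b x [] _ = refl
    coeff-without-other b x ((k , y) ∷ w) b≢x with eq x y in e
    ... | true with eq⇒≡ e
    ...   | ≡.refl rewrite b≢x = coeff-without-other b x w b≢x
    coeff-without-other b x ((k , y) ∷ w) b≢x | false with eq b y
    ... | true = +-congˡ (coeff-without-other b x w b≢x)
    ... | false = coeff-without-other b x w b≢x

    -- n is fuel: the recursive call is on without x w, which is not a subterm of w.
    eval-null : ∀ n w → length w ≤ n → (∀ b → coeff eq b w ≈ 0#) → ∀ g → eval g w ≈ 0#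
    eval-null _ [] _ _ g = refl
    eval-null (suc n) w@((k , x) ∷ w′) (s≤s |w′|≤n) null g = begin
      eval g w                                  ≈⟨ eval-without g x w ⟩
      coeff eq x w * g x + eval g (without x w) ≈⟨ +-cong (trans (*-congʳ (null x)) (zeroˡ _)) rest ⟩
      0# + 0#                                   ≈⟨ +-identityˡ 0# ⟩
      0#                                        ∎
      where
      null-without : ∀ b → coeff eq b (without x w) ≈ 0#
      null-without b with eq b x in e
      ... | true with eq⇒≡ e
      ...   | ≡.refl = coeff-without-self x w
      null-without b | false = trans (coeff-without-other b x w e) (null b)
      rest : eval g (without x w) ≈ 0#
      rest = eval-null n (without x w) (≤-trans (length-without-head x k w′) |w′|≤n) null-without g

    coeffs⇒≐ : ∀ {u v} → (∀ b → coeff eq b u ≈ coeff eq b v) → u ≐ v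
    coeffs⇒≐ {u} {v} same .≐-eval g = x∙y⁻¹≈ε⇒x≈y _ _ (begin
      eval g u - eval g v     ≈⟨ +-congˡ (eval-⊖ g v) ⟨
      eval g u + eval g (⊖ v) ≈⟨ eval-⊕ g u (⊖ v) ⟨
      eval g (u ⊕ (⊖ v))      ≈⟨ eval-null _ (u ⊕ (⊖ v)) ≤-refl difference-null g ⟩
      0#                      ∎)
      where
      difference-null : ∀ b → coeff eq b (u ⊕ (⊖ v)) ≈ 0#
      difference-null b = begin
        coeff eq b (u ⊕ (⊖ v))              ≈⟨ coeff≈eval-δ b (u ⊕ (⊖ v)) ⟩
        eval (δ b) (u ⊕ (⊖ v))              ≈⟨ trans (eval-⊕ (δ b) u (⊖ v)) (+-congˡ (eval-⊖ (δ b) v)) ⟩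
        eval (δ b) u - eval (δ b) v         ≈⟨ +-cong (coeff≈eval-δ b u) (-‿cong (coeff≈eval-δ b v)) ⟨
        coeff eq b u - coeff eq b v         ≈⟨ x≈y⇒x∙y⁻¹≈ε (same b) ⟩
        0#                                  ∎

    ≐⇒coeffs : ∀ {u v} → u ≐ v → ∀ b → coeff eq b u ≈ coeff eq b v
    ≐⇒coeffs {u} {v} u≐v b =
      trans (coeff≈eval-δ b u) (trans (≐-eval u≐v (δ b)) (sym (coeff≈eval-δ b v)))

  module TreeCoefficients = Coefficients eqT eqT⇒≡ eqT-refl
  module PairCoefficients = Coefficients eqT² eqT²⇒≡ eqT²-refl

  ≈⊗⇒≐ : ∀ u v → u ≈⊗ v → u ≐ v
  ≈⊗⇒≐ u v = PairCoefficients.coeffs⇒≐ {u} {v}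

  ≐⇒≈⊗ : ∀ {u v} → u ≐ v → u ≈⊗ v
  ≐⇒≈⊗ {u} {v} = PairCoefficients.≐⇒coeffs {u} {v}

  ⊕-commutativeMonoid : Set → CommutativeMonoid c (c ⊔ ℓ)
  ⊕-commutativeMonoid B = record
    { Carrier = LC B
    ; _≈_ = _≐_
    ; _∙_ = _⊕_
    ; ε = []
    ; isCommutativeMonoid = record
      { isMonoid = record
        { isSemigroup = record
          { isMagma = record
            { isEquivalence = record
              { refl = record { ≐-eval = λ _ → refl }
              ; sym = λ u≐v → record { ≐-eval = λ g → sym (≐-eval u≐v g) }
              ; trans = λ u≐v v≐w → record { ≐-eval = λ g → trans (≐-eval u≐v g) (≐-eval v≐w g) }
              }
            ; ∙-cong = λ {u} {u′} {v} {v′} u≐u′ v≐v′ → record { ≐-eval = λ g →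
                trans (eval-⊕ g u v)
                  (trans (+-cong (≐-eval u≐u′ g) (≐-eval v≐v′ g)) (sym (eval-⊕ g u′ v′))) }
            }
          ; assoc = λ u v w → record { ≐-eval = λ g → reflexive (≡.cong (eval g) (++-assoc u v w)) }
          }
        ; identity = (λ _ → record { ≐-eval = λ _ → refl })
                   , (λ u → record { ≐-eval = λ g → reflexive (≡.cong (eval g) (++-identityʳ u)) })
        }
      ; comm = λ u v → record { ≐-eval = λ g →
          trans (eval-⊕ g u v) (trans (+-comm _ _) (sym (eval-⊕ g v u))) }
      }
    }

  module _ {A B C : Set} (f : A → B → List C) where

    bilin-congˡ : ∀ {u u′} v → u ≐ u′ → bilin f u v ≐ bilin f u′ v
    bilin-congˡ {u} {u′} v u≐u′ .≐-eval g =
      trans (eval-bilin f g u v) (trans (≐-eval u≐u′ _) (sym (eval-bilin f g u′ v)))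

    bilin-congʳ : ∀ u {v v′} → v ≐ v′ → bilin f u v ≐ bilin f u v′
    bilin-congʳ u {v} {v′} v≐v′ .≐-eval g =
      trans (eval-bilin f g u v) (trans (eval-cong u (λ _ → ≐-eval v≐v′ _)) (sym (eval-bilin f g u v′)))

    bilin-⊕ˡ : ∀ u u′ v → bilin f (u ⊕ u′) v ≐ bilin f u v ⊕ bilin f u′ v
    bilin-⊕ˡ u u′ v .≐-eval g =
      trans (eval-bilin f g (u ⊕ u′) v) (trans (eval-⊕ _ u u′) (sym (trans
        (eval-⊕ g (bilin f u v) (bilin f u′ v)) (+-cong (eval-bilin f g u v) (eval-bilin f g u′ v)))))

    bilin-⊕ʳ : ∀ u v v′ → bilin f u (v ⊕ v′) ≐ bilin f u v ⊕ bilin f u v′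
    bilin-⊕ʳ u v v′ .≐-eval g =
      trans (eval-bilin f g u (v ⊕ v′))
        (trans (eval-cong u (λ _ → eval-⊕ _ v v′)) (trans (eval-+ _ _ u) (sym (trans
          (eval-⊕ g (bilin f u v) (bilin f u v′)) (+-cong (eval-bilin f g u v) (eval-bilin f g u v′))))))

    bilin-zeroʳ : ∀ u → bilin f u [] ≐ []
    bilin-zeroʳ u .≐-eval g = trans (eval-bilin f g u []) (eval-0 u)

  bilin-zero : {A B C : Set} (u : LC A) (v : LC B) → bilin {C = C} (λ _ _ → []) u v ≐ []
  bilin-zero u v .≐-eval g = trans (eval-bilin _ g u v) (trans (eval-cong u (λ _ → eval-0 v)) (eval-0 u))

  eval-swap : {A B : Set} (F : A → B → Carrier) (u : LC A) (v : LC B) →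
    eval (λ x → eval (F x) v) u ≈ eval (λ y → eval (λ x → F x y) u) v
  eval-swap F [] v = sym (eval-0 v)
  eval-swap F ((k , x) ∷ u) v = begin
    k * eval (F x) v + eval (λ x → eval (F x) v) u
      ≈⟨ +-cong (sym (eval-*ˡ k (F x) v)) (eval-swap F u v) ⟩
    eval (λ y → k * F x y) v + eval (λ y → eval (λ x → F x y) u) v
      ≈⟨ eval-+ _ _ v ⟨
    eval (λ y → k * F x y + eval (λ x → F x y) u) v
      ∎

  eval-⊗ : (g : Tree × Tree → Carrier) (u v : 𝒜) → eval g (u ⊗ v) ≈ eval (λ x → eval (λ y → g (x , y)) v) u
  eval-⊗ g u v = trans (eval-bilin (λ x y → (x , y) ∷ []) g u v)
                       (eval-cong u (λ x → eval-cong v (λ y → +-identityʳ _)))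

  eval-𝟙 : (h : Tree → Carrier) → eval h 𝟙 ≈ h leaf
  eval-𝟙 h = eval-⟨⟩ h leaf

  eval-𝟙⊗ : (g : Tree × Tree → Carrier) (u : 𝒜) → eval g (𝟙 ⊗ u) ≈ eval (λ y → g (leaf , y)) u
  eval-𝟙⊗ g u = trans (eval-⊗ g 𝟙 u) (eval-𝟙 (λ x → eval (λ y → g (x , y)) u))

  eval-⊗𝟙 : (g : Tree × Tree → Carrier) (u : 𝒜) → eval g (u ⊗ 𝟙) ≈ eval (λ x → g (x , leaf)) u
  eval-⊗𝟙 g u = trans (eval-⊗ g u 𝟙) (eval-cong u (λ x → eval-𝟙 (λ y → g (x , y))))

  eval-cong-difference : {B : Set} (g g′ : B → Carrier) (u : LC B) →
    eval (λ x → g x - g′ x) u ≈ 0# → eval g u ≈ eval g′ u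
  eval-cong-difference g g′ u difference≈0 = x∙y⁻¹≈ε⇒x≈y _ _ (begin
    eval g u - eval g′ u             ≈⟨ +-congˡ (eval-neg g′ u) ⟨
    eval g u + eval (λ x → - g′ x) u ≈⟨ eval-+ g _ u ⟨
    eval (λ x → g x - g′ x) u        ≈⟨ difference≈0 ⟩
    0#                               ∎)

  eval-cong-In𝒜⁺ : ∀ u → In𝒜⁺ u → {h h′ : Tree → Carrier} →
    (∀ a ms b → h (node a ms b) ≈ h′ (node a ms b)) → eval h u ≈ eval h′ u
  eval-cong-In𝒜⁺ u u∈𝒜⁺ {h} {h′} agree = eval-cong-difference h h′ u (begin
    eval (λ x → h x - h′ x) u        ≈⟨ eval-cong u difference ⟩
    eval (λ x → d * δ leaf x) u      ≈⟨ eval-*ˡ d (δ leaf) u ⟩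
    d * eval (δ leaf) u              ≈⟨ *-congˡ (trans (sym (coeff≈eval-δ leaf u)) u∈𝒜⁺) ⟩
    d * 0#                           ≈⟨ zeroʳ d ⟩
    0#                               ∎)
    where
    open TreeCoefficients using (δ; coeff≈eval-δ)
    d : Carrier
    d = h leaf - h′ leaf
    difference : ∀ x → h x - h′ x ≈ d * δ leaf x
    difference leaf = sym (*-identityʳ d)
    difference (node a ms b) = trans (x≈y⇒x∙y⁻¹≈ε (agree a ms b)) (sym (zeroʳ d))

  atRightLeaf : (Tree → Carrier) → Tree × Tree → Carrier
  atRightLeaf h (a , leaf) = h a
  atRightLeaf h (a , node _ _ _) = 0#

  In𝒜⊗𝒜⁺ : 𝒜⊗𝒜 → Set (c ⊔ ℓ)
  In𝒜⊗𝒜⁺ W = ∀ h → eval (atRightLeaf h) W ≈ 0#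

  eval-cong-In𝒜⊗𝒜⁺ : ∀ W → In𝒜⊗𝒜⁺ W → {H H′ : Tree × Tree → Carrier} →
    (∀ a b₁ bs b₂ → H (a , node b₁ bs b₂) ≈ H′ (a , node b₁ bs b₂)) → eval H W ≈ eval H′ W
  eval-cong-In𝒜⊗𝒜⁺ W W∈𝒜⊗𝒜⁺ {H} {H′} agree = eval-cong-difference H H′ W
    (trans (eval-cong W difference) (W∈𝒜⊗𝒜⁺ _))
    where
    difference : ∀ p → H p - H′ p ≈ atRightLeaf (λ a → H (a , leaf) - H′ (a , leaf)) p
    difference (a , leaf) = refl
    difference (a , node b₁ bs b₂) = x≈y⇒x∙y⁻¹≈ε (agree a b₁ bs b₂)

  sumBy-atRightLeaf-cart : (h : Tree → Carrier) (xs ys : List Tree) → All IsNode ys →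
    sumBy (atRightLeaf h) (cart xs ys) ≈ 0#
  sumBy-atRightLeaf-cart h xs ys ys-nodes = begin
    sumBy (atRightLeaf h) (cart xs ys)
      ≈⟨ sumBy-concatMap _ _ xs ⟩
    sumBy (λ x → sumBy (atRightLeaf h) (map (x ,_) ys)) xs
      ≈⟨ sumBy-cong xs (λ x → trans (sumBy-map _ _ ys) (vanish x ys ys-nodes)) ⟩
    sumBy (λ _ → 0#) xs
      ≈⟨ sumBy-0 xs ⟩
    0#
      ∎
    where
    vanish : ∀ x ys → All IsNode ys → sumBy (λ y → atRightLeaf h (x , y)) ys ≈ 0#
    vanish x [] [] = refl
    vanish x (leaf ∷ _) (() ∷ _)
    vanish x (node _ _ _ ∷ ys) (_ ∷ ys-nodes) = trans (+-identityˡ _) (vanish x ys ys-nodes)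

  atRightLeaf-lift² : ∀ {op} → RespectsAugmentation op → ∀ h p q →
    sumBy (atRightLeaf h) (lift² op p q) ≈ atRightLeaf (λ a → atRightLeaf (λ c → sumBy h (op a c)) q) p
  atRightLeaf-lift² {op} _ h (a , leaf) (c , leaf) = sumBy-map _ _ (op a c)
  atRightLeaf-lift² aug h (a , leaf) (c , node d₁ ds d₂) =
    sumBy-atRightLeaf-cart h (starT a c) _ (RespectsAugmentation.nodeʳ aug leaf d₁ ds d₂)
  atRightLeaf-lift² aug h (a , node b₁ bs b₂) (c , d) =
    sumBy-atRightLeaf-cart h (starT a c) _ (RespectsAugmentation.nodeˡ aug b₁ bs b₂ d)

  module _ (f : Tree → Tree → List Tree) where

    eval-bilin-𝟙ˡ : (g : Tree → Carrier) (v : 𝒜) → eval g (bilin f 𝟙 v) ≈ eval (λ y → sumBy g (f leaf y)) v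
    eval-bilin-𝟙ˡ g v = trans (eval-bilin f g 𝟙 v) (eval-𝟙 (λ x → eval (λ y → sumBy g (f x y)) v))

    eval-bilin-𝟙ʳ : (g : Tree → Carrier) (u : 𝒜) → eval g (bilin f u 𝟙) ≈ eval (λ x → sumBy g (f x leaf)) u
    eval-bilin-𝟙ʳ g u = trans (eval-bilin f g u 𝟙) (eval-cong u (λ x → eval-𝟙 (λ y → sumBy g (f x y))))

  ≺-𝟙 : ∀ u → In𝒜⁺ u → u ≺ 𝟙 ≐ u
  ≺-𝟙 u u∈𝒜⁺ .≐-eval g =
    trans (eval-bilin-𝟙ʳ precT g u) (eval-cong-In𝒜⁺ u u∈𝒜⁺ (λ a ms b → +-identityʳ (g (node a ms b))))

  𝟙-≺ : ∀ v → 𝟙 ≺ v ≐ []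
  𝟙-≺ v .≐-eval g = trans (eval-bilin-𝟙ˡ precT g v) (eval-0 v)

  ·-𝟙 : ∀ u → u · 𝟙 ≐ []
  ·-𝟙 u .≐-eval g = trans (eval-bilin-𝟙ʳ dotT g u) (trans (eval-cong u vanish) (eval-0 u))
    where
    vanish : ∀ x → sumBy g (dotT x leaf) ≈ 0#
    vanish leaf = refl
    vanish (node _ _ _) = refl

  𝟙-· : ∀ v → 𝟙 · v ≐ []
  𝟙-· v .≐-eval g = trans (eval-bilin-𝟙ˡ dotT g v) (eval-0 v)

  ≻-𝟙 : ∀ u → In𝒜⁺ u → u ≻ 𝟙 ≐ []
  ≻-𝟙 u u∈𝒜⁺ .≐-eval g =
    trans (eval-bilin-𝟙ʳ succT g u) (trans (eval-cong-In𝒜⁺ u u∈𝒜⁺ {h′ = λ _ → 0#} (λ _ _ _ → refl)) (eval-0 u))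

  𝟙-≻ : ∀ v → 𝟙 ≻ v ≐ v
  𝟙-≻ v .≐-eval g = trans (eval-bilin-𝟙ˡ succT g v) (eval-cong v (λ y → +-identityʳ (g y)))

  sumBy-cart-[] : (g : Tree × Tree → Carrier) (xs : List Tree) → sumBy g (cart xs []) ≈ 0#
  sumBy-cart-[] g xs = trans (sumBy-concatMap g (λ x → map (x ,_) []) xs) (sumBy-0 xs)

  sumBy-cart-∷[] : (g : Tree × Tree → Carrier) (x : Tree) (ys : List Tree) →
    sumBy g (cart (x ∷ []) ys) ≈ sumBy (λ y → g (x , y)) ys
  sumBy-cart-∷[] g x ys =
    trans (sumBy-concatMap g (λ x → map (x ,_) ys) (x ∷ [])) (trans (+-identityʳ _) (sumBy-map g _ ys))

  module _ (op : Tree → Tree → List Tree) where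

    lift²-𝟙⊗-𝟙⊗ : All (_≡ leaf) (op leaf leaf) → ∀ u v → bilin (lift² op) (𝟙 ⊗ u) (𝟙 ⊗ v) ≐ 𝟙 ⊗ bilin op u v
    lift²-𝟙⊗-𝟙⊗ leaves u v .≐-eval g = begin
      eval g (bilin (lift² op) (𝟙 ⊗ u) (𝟙 ⊗ v))
        ≈⟨ trans (eval-bilin (lift² op) g (𝟙 ⊗ u) (𝟙 ⊗ v)) (eval-𝟙⊗ _ u) ⟩
      eval (λ y → eval (λ q → sumBy g (lift² op (leaf , y) q)) (𝟙 ⊗ v)) u
        ≈⟨ eval-cong u (λ y → trans (eval-𝟙⊗ _ v) (eval-cong v (kernel y))) ⟩
      eval (λ y → eval (λ y′ → sumBy (λ z → g (leaf , z)) (op y y′)) v) u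
        ≈⟨ eval-bilin op _ u v ⟨
      eval (λ z → g (leaf , z)) (bilin op u v)
        ≈⟨ eval-𝟙⊗ g (bilin op u v) ⟨
      eval g (𝟙 ⊗ bilin op u v)
        ∎
      where
      transpose : ∀ zs → All (_≡ leaf) zs → sumBy g (map (_, leaf) zs) ≈ sumBy (λ z → g (leaf , z)) zs
      transpose [] [] = refl
      transpose (_ ∷ zs) (≡.refl ∷ leaves) = +-congˡ (transpose zs leaves)
      kernel : ∀ y y′ → sumBy g (lift² op (leaf , y) (leaf , y′)) ≈ sumBy (λ z → g (leaf , z)) (op y y′)
      kernel leaf leaf = transpose (op leaf leaf) leaves
      kernel leaf y′@(node _ _ _) = sumBy-cart-∷[] g leaf (op leaf y′)
      kernel y@(node _ _ _) y′ = sumBy-cart-∷[] g leaf (op y y′)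

    lift²-⊗𝟙-⊗𝟙 : ∀ u v → bilin (lift² op) (u ⊗ 𝟙) (v ⊗ 𝟙) ≐ bilin op u v ⊗ 𝟙
    lift²-⊗𝟙-⊗𝟙 u v .≐-eval g = begin
      eval g (bilin (lift² op) (u ⊗ 𝟙) (v ⊗ 𝟙))
        ≈⟨ trans (eval-bilin (lift² op) g (u ⊗ 𝟙) (v ⊗ 𝟙)) (eval-⊗𝟙 _ u) ⟩
      eval (λ x → eval (λ q → sumBy g (lift² op (x , leaf) q)) (v ⊗ 𝟙)) u
        ≈⟨ eval-cong u (λ x → trans (eval-⊗𝟙 _ v) (eval-cong v (λ x′ → sumBy-map g _ (op x x′)))) ⟩
      eval (λ x → eval (λ x′ → sumBy (λ z → g (z , leaf)) (op x x′)) v) u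
        ≈⟨ eval-bilin op _ u v ⟨
      eval (λ z → g (z , leaf)) (bilin op u v)
        ≈⟨ eval-⊗𝟙 g (bilin op u v) ⟨
      eval g (bilin op u v ⊗ 𝟙)
        ∎

    lift²-𝟙⊗-⊗𝟙 : ∀ u v → In𝒜⁺ u → bilin (lift² op) (𝟙 ⊗ u) (v ⊗ 𝟙) ≐ v ⊗ bilin op u 𝟙
    lift²-𝟙⊗-⊗𝟙 u v u∈𝒜⁺ .≐-eval g = begin
      eval g (bilin (lift² op) (𝟙 ⊗ u) (v ⊗ 𝟙))
        ≈⟨ trans (eval-bilin (lift² op) g (𝟙 ⊗ u) (v ⊗ 𝟙)) (eval-𝟙⊗ _ u) ⟩
      eval (λ y → eval (λ q → sumBy g (lift² op (leaf , y) q)) (v ⊗ 𝟙)) u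
        ≈⟨ eval-cong u (λ y → eval-⊗𝟙 _ v) ⟩
      eval (λ y → eval (λ x → sumBy g (lift² op (leaf , y) (x , leaf))) v) u
        ≈⟨ eval-cong-In𝒜⁺ u u∈𝒜⁺ (λ a ms b →
             eval-cong v (λ x → sumBy-cart-∷[] g x (op (node a ms b) leaf))) ⟩
      eval (λ y → eval (λ x → sumBy (λ z → g (x , z)) (op y leaf)) v) u
        ≈⟨ eval-swap _ u v ⟩
      eval (λ x → eval (λ y → sumBy (λ z → g (x , z)) (op y leaf)) u) v
        ≈⟨ eval-cong v (λ x → eval-bilin-𝟙ʳ op _ u) ⟨
      eval (λ x → eval (λ z → g (x , z)) (bilin op u 𝟙)) v
        ≈⟨ eval-⊗ g v (bilin op u 𝟙) ⟨
      eval g (v ⊗ bilin op u 𝟙)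
        ∎

    lift²-⊗𝟙-𝟙⊗ : ∀ u v → In𝒜⁺ v → bilin (lift² op) (u ⊗ 𝟙) (𝟙 ⊗ v) ≐ u ⊗ bilin op 𝟙 v
    lift²-⊗𝟙-𝟙⊗ u v v∈𝒜⁺ .≐-eval g = begin
      eval g (bilin (lift² op) (u ⊗ 𝟙) (𝟙 ⊗ v))
        ≈⟨ trans (eval-bilin (lift² op) g (u ⊗ 𝟙) (𝟙 ⊗ v)) (eval-⊗𝟙 _ u) ⟩
      eval (λ x → eval (λ q → sumBy g (lift² op (x , leaf) q)) (𝟙 ⊗ v)) u
        ≈⟨ eval-cong u (λ x → trans (eval-𝟙⊗ _ v) (eval-cong-In𝒜⁺ v v∈𝒜⁺ (kernel x))) ⟩
      eval (λ x → eval (λ y → sumBy (λ z → g (x , z)) (op leaf y)) v) u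
        ≈⟨ eval-cong u (λ x → eval-bilin-𝟙ˡ op _ v) ⟨
      eval (λ x → eval (λ z → g (x , z)) (bilin op 𝟙 v)) u
        ≈⟨ eval-⊗ g u (bilin op 𝟙 v) ⟨
      eval g (u ⊗ bilin op 𝟙 v)
        ∎
      where
      kernel : ∀ x a ms b →
        sumBy g (lift² op (x , leaf) (leaf , node a ms b)) ≈ sumBy (λ z → g (x , z)) (op leaf (node a ms b))
      kernel leaf a ms b = sumBy-cart-∷[] g leaf (op leaf (node a ms b))
      kernel x@(node _ _ _) a ms b = sumBy-cart-∷[] g x (op leaf (node a ms b))

  module _ (F F′ : Tree × Tree → Tree × Tree → List (Tree × Tree)) where

    bilin-⊗𝟙-In𝒜⊗𝒜⁺ :
      (∀ g x a b₁ bs b₂ →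
         sumBy g (F (x , leaf) (a , node b₁ bs b₂)) ≈ sumBy g (F′ (x , leaf) (a , node b₁ bs b₂))) →
      ∀ u W → In𝒜⊗𝒜⁺ W → bilin F (u ⊗ 𝟙) W ≐ bilin F′ (u ⊗ 𝟙) W
    bilin-⊗𝟙-In𝒜⊗𝒜⁺ agree u W W∈𝒜⊗𝒜⁺ .≐-eval g = begin
      eval g (bilin F (u ⊗ 𝟙) W)
        ≈⟨ trans (eval-bilin F g (u ⊗ 𝟙) W) (eval-⊗𝟙 _ u) ⟩
      eval (λ x → eval (λ q → sumBy g (F (x , leaf) q)) W) u
        ≈⟨ eval-cong u (λ x → eval-cong-In𝒜⊗𝒜⁺ W W∈𝒜⊗𝒜⁺ (agree g x)) ⟩
      eval (λ x → eval (λ q → sumBy g (F′ (x , leaf) q)) W) u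
        ≈⟨ trans (eval-bilin F′ g (u ⊗ 𝟙) W) (eval-⊗𝟙 _ u) ⟨
      eval g (bilin F′ (u ⊗ 𝟙) W)
        ∎

    bilin-In𝒜⊗𝒜⁺-⊗𝟙 :
      (∀ g a b₁ bs b₂ x →
         sumBy g (F (a , node b₁ bs b₂) (x , leaf)) ≈ sumBy g (F′ (a , node b₁ bs b₂) (x , leaf))) →
      ∀ W v → In𝒜⊗𝒜⁺ W → bilin F W (v ⊗ 𝟙) ≐ bilin F′ W (v ⊗ 𝟙)
    bilin-In𝒜⊗𝒜⁺-⊗𝟙 agree W v W∈𝒜⊗𝒜⁺ .≐-eval g = begin
      eval g (bilin F W (v ⊗ 𝟙))
        ≈⟨ trans (eval-bilin F g W (v ⊗ 𝟙)) (eval-cong W (λ p → eval-⊗𝟙 _ v)) ⟩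
      eval (λ p → eval (λ x → sumBy g (F p (x , leaf))) v) W
        ≈⟨ eval-cong-In𝒜⊗𝒜⁺ W W∈𝒜⊗𝒜⁺ (λ a b₁ bs b₂ → eval-cong v (agree g a b₁ bs b₂)) ⟩
      eval (λ p → eval (λ x → sumBy g (F′ p (x , leaf))) v) W
        ≈⟨ trans (eval-bilin F′ g W (v ⊗ 𝟙)) (eval-cong W (λ p → eval-⊗𝟙 _ v)) ⟨
      eval g (bilin F′ W (v ⊗ 𝟙))
        ∎

  module _ (op : Tree → Tree → List Tree) where

    lift²-⊗𝟙-In𝒜⊗𝒜⁺-vanish : (∀ a ms b → op leaf (node a ms b) ≡ []) →
      ∀ u W → In𝒜⊗𝒜⁺ W → bilin (lift² op) (u ⊗ 𝟙) W ≐ []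
    lift²-⊗𝟙-In𝒜⊗𝒜⁺-vanish vanish u W W∈𝒜⊗𝒜⁺ .≐-eval g =
      trans (≐-eval (bilin-⊗𝟙-In𝒜⊗𝒜⁺ (lift² op) (λ _ _ → []) agree u W W∈𝒜⊗𝒜⁺) g)
            (≐-eval (bilin-zero (u ⊗ 𝟙) W) g)
      where
      agree : ∀ g x a b₁ bs b₂ → sumBy g (lift² op (x , leaf) (a , node b₁ bs b₂)) ≈ 0#
      agree g x a b₁ bs b₂ rewrite vanish b₁ bs b₂ = sumBy-cart-[] g (starT x a)

    lift²-In𝒜⊗𝒜⁺-⊗𝟙-vanish : (∀ a ms b → op (node a ms b) leaf ≡ []) →
      ∀ W v → In𝒜⊗𝒜⁺ W → bilin (lift² op) W (v ⊗ 𝟙) ≐ []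
    lift²-In𝒜⊗𝒜⁺-⊗𝟙-vanish vanish W v W∈𝒜⊗𝒜⁺ .≐-eval g =
      trans (≐-eval (bilin-In𝒜⊗𝒜⁺-⊗𝟙 (lift² op) (λ _ _ → []) agree W v W∈𝒜⊗𝒜⁺) g)
            (≐-eval (bilin-zero W (v ⊗ 𝟙)) g)
      where
      agree : ∀ g a b₁ bs b₂ x → sumBy g (lift² op (a , node b₁ bs b₂) (x , leaf)) ≈ 0#
      agree g a b₁ bs b₂ x rewrite vanish b₁ bs b₂ = sumBy-cart-[] g (starT a x)

  module _ (Δ : Tree → 𝒜⊗𝒜) where

    eval-linExt-⟨⟩ : (g : Tree × Tree → Carrier) (x : Tree) → eval g (linExt Δ ⟨ x ⟩) ≈ eval g (Δ x)
    eval-linExt-⟨⟩ g x = trans (eval-linExt Δ g ⟨ x ⟩) (eval-⟨⟩ (λ y → eval g (Δ y)) x)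

    linExt-cong : ∀ {u v} → u ≐ v → linExt Δ u ≐ linExt Δ v
    linExt-cong {u} {v} u≐v .≐-eval g =
      trans (eval-linExt Δ g u) (trans (≐-eval u≐v _) (sym (eval-linExt Δ g v)))

    eval-Δ̃ : (g : Tree × Tree → Carrier) (x : 𝒜) →
      eval g (Δ̃ Δ x) ≈ eval g (linExt Δ x) - (eval g (𝟙 ⊗ x) + eval g (x ⊗ 𝟙))
    eval-Δ̃ g x = begin
      eval g (Δ̃ Δ x)
        ≈⟨ trans (eval-⊕ g (linExt Δ x) ((⊖ (𝟙 ⊗ x)) ⊕ (⊖ (x ⊗ 𝟙))))
                 (+-congˡ (eval-⊕ g (⊖ (𝟙 ⊗ x)) (⊖ (x ⊗ 𝟙)))) ⟩
      eval g (linExt Δ x) + (eval g (⊖ (𝟙 ⊗ x)) + eval g (⊖ (x ⊗ 𝟙)))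
        ≈⟨ +-congˡ (+-cong (eval-⊖ g (𝟙 ⊗ x)) (eval-⊖ g (x ⊗ 𝟙))) ⟩
      eval g (linExt Δ x) + (- eval g (𝟙 ⊗ x) + - eval g (x ⊗ 𝟙))
        ≈⟨ +-congˡ (⁻¹-∙-comm _ _) ⟩
      eval g (linExt Δ x) - (eval g (𝟙 ⊗ x) + eval g (x ⊗ 𝟙))
        ∎

    linExt≐𝟙⊗⊕⊗𝟙⊕Δ̃ : ∀ x → linExt Δ x ≐ (𝟙 ⊗ x) ⊕ ((x ⊗ 𝟙) ⊕ Δ̃ Δ x)
    linExt≐𝟙⊗⊕⊗𝟙⊕Δ̃ x .≐-eval g = sym (begin
      eval g ((𝟙 ⊗ x) ⊕ ((x ⊗ 𝟙) ⊕ Δ̃ Δ x)) ≈⟨ eval-⊕₃ g (𝟙 ⊗ x) (x ⊗ 𝟙) (Δ̃ Δ x) ⟩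
      a + (b + eval g (Δ̃ Δ x))            ≈⟨ +-assoc a b _ ⟨
      (a + b) + eval g (Δ̃ Δ x)            ≈⟨ +-congˡ (eval-Δ̃ g x) ⟩
      (a + b) + (e - (a + b))             ≈⟨ +-assoc (a + b) e _ ⟨
      (a + b) + e - (a + b)               ≈⟨ xyx⁻¹≈y (a + b) e ⟩
      e                                   ∎)
      where
      a = eval g (𝟙 ⊗ x)
      b = eval g (x ⊗ 𝟙)
      e = eval g (linExt Δ x)

    Δ̃-≐ : ∀ x r → linExt Δ x ≐ (𝟙 ⊗ x) ⊕ ((x ⊗ 𝟙) ⊕ r) → Δ̃ Δ x ≐ r
    Δ̃-≐ x r decomposition .≐-eval g = begin
      eval g (Δ̃ Δ x)                ≈⟨ eval-Δ̃ g x ⟩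
      eval g (linExt Δ x) - (a + b) ≈⟨ +-congʳ (trans (≐-eval decomposition g) (eval-⊕₃ g (𝟙 ⊗ x) (x ⊗ 𝟙) r)) ⟩
      a + (b + eval g r) - (a + b)  ≈⟨ +-congʳ (+-assoc a b _) ⟨
      (a + b) + eval g r - (a + b)  ≈⟨ xyx⁻¹≈y (a + b) _ ⟩
      eval g r                      ∎
      where
      a = eval g (𝟙 ⊗ x)
      b = eval g (x ⊗ 𝟙)

    Multiplicative : (Tree → Tree → List Tree) → Set (c ⊔ ℓ)
    Multiplicative op = ∀ u v → In𝒜⁺ u → In𝒜⁺ v →
      linExt Δ (bilin op u v) ≈⊗ bilin (lift² op) (linExt Δ u) (linExt Δ v)

    RightUnitComponent : Tree → Set (c ⊔ ℓ)
    RightUnitComponent x = ∀ h → eval (atRightLeaf h) (Δ x) ≈ h x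

    rightUnitComponent-product : ∀ {op} → Multiplicative op → RespectsAugmentation op → ∀ u v {x} →
      In𝒜⁺ ⟨ u ⟩ → In𝒜⁺ ⟨ v ⟩ → op u v ≡ x ∷ [] →
      RightUnitComponent u → RightUnitComponent v → RightUnitComponent x
    rightUnitComponent-product {op} mult aug u v {x} u∈𝒜⁺ v∈𝒜⁺ uv≡x Ru Rv h = begin
      eval ρ (Δ x)
        ≈⟨ trans (≐-eval (linExt-cong product≐x) ρ) (eval-linExt-⟨⟩ ρ x) ⟨
      eval ρ (linExt Δ (bilin op ⟨ u ⟩ ⟨ v ⟩))
        ≈⟨ ≈⊗⇒≐ (linExt Δ (bilin op ⟨ u ⟩ ⟨ v ⟩)) (bilin (lift² op) (linExt Δ ⟨ u ⟩) (linExt Δ ⟨ v ⟩))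
                (mult ⟨ u ⟩ ⟨ v ⟩ u∈𝒜⁺ v∈𝒜⁺) .≐-eval ρ ⟩
      eval ρ (bilin (lift² op) (linExt Δ ⟨ u ⟩) (linExt Δ ⟨ v ⟩))
        ≈⟨ trans (eval-bilin (lift² op) ρ (linExt Δ ⟨ u ⟩) (linExt Δ ⟨ v ⟩))
             (trans (eval-linExt-⟨⟩ (λ p → eval (λ q → sumBy ρ (lift² op p q)) (linExt Δ ⟨ v ⟩)) u)
               (eval-cong (Δ u) (λ p → eval-linExt-⟨⟩ (λ q → sumBy ρ (lift² op p q)) v))) ⟩
      eval (λ p → eval (λ q → sumBy ρ (lift² op p q)) (Δ v)) (Δ u)
        ≈⟨ eval-cong (Δ u) (λ p → trans (eval-cong (Δ v) (atRightLeaf-lift² aug h p)) (pull p)) ⟩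
      eval (atRightLeaf (λ a → eval (atRightLeaf (F a)) (Δ v))) (Δ u)
        ≈⟨ Ru _ ⟩
      eval (atRightLeaf (F u)) (Δ v)
        ≈⟨ Rv (F u) ⟩
      sumBy h (op u v)
        ≈⟨ trans (reflexive (≡.cong (sumBy h) uv≡x)) (+-identityʳ (h x)) ⟩
      h x
        ∎
      where
      ρ : Tree × Tree → Carrier
      ρ = atRightLeaf h
      F : Tree → Tree → Carrier
      F a c = sumBy h (op a c)
      product≐x : bilin op ⟨ u ⟩ ⟨ v ⟩ ≐ ⟨ x ⟩
      product≐x .≐-eval g = begin
        eval g (bilin op ⟨ u ⟩ ⟨ v ⟩) ≈⟨ trans (eval-bilin op g ⟨ u ⟩ ⟨ v ⟩)
                                          (trans (eval-⟨⟩ (λ a → eval (λ b → sumBy g (op a b)) ⟨ v ⟩) u)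
                                            (eval-⟨⟩ (λ b → sumBy g (op u b)) v)) ⟩
        sumBy g (op u v)             ≈⟨ reflexive (≡.cong (sumBy g) uv≡x) ⟩
        g x + 0#                     ≈⟨ +-congʳ (*-identityˡ (g x)) ⟨
        eval g ⟨ x ⟩                 ∎
      pull : ∀ p → eval (λ q → atRightLeaf (λ a → atRightLeaf (F a) q) p) (Δ v) ≈
                   atRightLeaf (λ a → eval (atRightLeaf (F a)) (Δ v)) p
      pull (a , leaf) = refl
      pull (a , node _ _ _) = eval-0 (Δ v)

    module _ (isΔ : IsCoproduct Δ) where
      open IsCoproduct isΔ

      rightUnitComponent-Y : RightUnitComponent Y
      rightUnitComponent-Y h = begin
        eval (atRightLeaf h) (Δ Y)  ≈⟨ ≈⊗⇒≐ (Δ Y) (⟨ (Y , leaf) ⟩ ⊕ ⟨ (leaf , Y) ⟩) Δ-Y .≐-eval (atRightLeaf h) ⟩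
        1# * h Y + (1# * 0# + 0#)   ≈⟨ +-congˡ (trans (+-identityʳ _) (zeroʳ 1#)) ⟩
        1# * h Y + 0#               ≈⟨ trans (+-identityʳ _) (*-identityˡ (h Y)) ⟩
        h Y                         ∎

      -- Every tree ≠ | is a product of smaller ones (down to Y):
      --   a ∨ | = a ≻ Y,   a ∨ m ∨ ms ∨ | = (a ∨ |) · (m ∨ ms ∨ |),   a ∨ ms ∨ b = (a ∨ ms ∨ |) ≺ b.
      mutual
        rightUnitComponent-node : ∀ a ms b → RightUnitComponent (node a ms b)
        rightUnitComponent-node a ms leaf = rightUnitComponent-lastLeaf a ms
        rightUnitComponent-node a ms b@(node b₁ bs b₂) =
          rightUnitComponent-product Δ-≺ ≺-respectsAugmentation (node a ms leaf) b refl refl ≡.refl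
            (rightUnitComponent-lastLeaf a ms) (rightUnitComponent-node b₁ bs b₂)

        rightUnitComponent-lastLeaf : ∀ a ms → RightUnitComponent (node a ms leaf)
        rightUnitComponent-lastLeaf a [] = rightUnitComponent-binary a
        rightUnitComponent-lastLeaf a (m ∷ ms) =
          rightUnitComponent-product Δ-· ·-respectsAugmentation (node a [] leaf) (node m ms leaf) refl refl ≡.refl
            (rightUnitComponent-binary a) (rightUnitComponent-lastLeaf m ms)

        rightUnitComponent-binary : ∀ a → RightUnitComponent (node a [] leaf)
        rightUnitComponent-binary leaf = rightUnitComponent-Y
        rightUnitComponent-binary a@(node a₁ as a₂) =
          rightUnitComponent-product Δ-≻ ≻-respectsAugmentation a Y refl refl ≡.refl
            (rightUnitComponent-node a₁ as a₂) rightUnitComponent-Y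

      Δ̃-In𝒜⊗𝒜⁺ : ∀ s → In𝒜⁺ s → In𝒜⊗𝒜⁺ (Δ̃ Δ s)
      Δ̃-In𝒜⊗𝒜⁺ s s∈𝒜⁺ h = begin
        eval ρ (Δ̃ Δ s)                                          ≈⟨ eval-Δ̃ ρ s ⟩
        eval ρ (linExt Δ s) - (eval ρ (𝟙 ⊗ s) + eval ρ (s ⊗ 𝟙)) ≈⟨ +-cong Δs (-‿cong (+-cong 𝟙⊗s s⊗𝟙)) ⟩
        eval h s - (0# + eval h s)                              ≈⟨ +-congˡ (-‿cong (+-identityˡ _)) ⟩
        eval h s - eval h s                                     ≈⟨ -‿inverseʳ _ ⟩
        0#                                                      ∎
        where
        ρ : Tree × Tree → Carrier
        ρ = atRightLeaf h
        Δs : eval ρ (linExt Δ s) ≈ eval h s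
        Δs = trans (eval-linExt Δ ρ s) (eval-cong-In𝒜⁺ s s∈𝒜⁺ (λ a ms b → rightUnitComponent-node a ms b h))
        𝟙⊗s : eval ρ (𝟙 ⊗ s) ≈ 0#
        𝟙⊗s = trans (eval-𝟙⊗ ρ s) (trans (eval-cong-In𝒜⁺ s s∈𝒜⁺ {h′ = λ _ → 0#} (λ _ _ _ → refl)) (eval-0 s))
        s⊗𝟙 : eval ρ (s ⊗ 𝟙) ≈ eval h s
        s⊗𝟙 = eval-⊗𝟙 ρ s

module TensorFormulas {c ℓ} (R : CommutativeRing c ℓ) where
  open Lin R
  open Evaluation R
  open CommutativeMonoid (⊕-commutativeMonoid (Tree × Tree)) using (setoid; refl; trans; ∙-cong)
  open CommutativeMonoidSolver (⊕-commutativeMonoid (Tree × Tree)) using (solve; _⊜_; id)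
    renaming (_⊕_ to _⊕′_)
  open CommutativeRing R using () renaming (refl to ≈-refl)
  open import Relation.Binary.Reasoning.Setoid setoid

  infix 25 _⋉[_]_
  _⋉[_]_ : 𝒜⊗𝒜 → (Tree → Tree → List Tree) → 𝒜⊗𝒜 → 𝒜⊗𝒜
  X ⋉[ op ] Y = bilin (lift² op) X Y

  ≐-refl : ∀ u → u ≐ u
  ≐-refl u = refl {u}

  ⊗-congʳ : ∀ u {v v′} → v ≐ v′ → u ⊗ v ≐ u ⊗ v′
  ⊗-congʳ = bilin-congʳ (λ x y → (x , y) ∷ [])

  ⊗-zeroʳ : ∀ u {v} → v ≐ [] → u ⊗ v ≐ []
  ⊗-zeroʳ u v≐[] = trans (⊗-congʳ u v≐[]) (bilin-zeroʳ (λ x y → (x , y) ∷ []) u)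

  bilin-⊕₃ : (F : Tree × Tree → Tree × Tree → List (Tree × Tree)) (X₁ X₂ X₃ Y₁ Y₂ Y₃ : 𝒜⊗𝒜) →
    bilin F (X₁ ⊕ (X₂ ⊕ X₃)) (Y₁ ⊕ (Y₂ ⊕ Y₃)) ≐
      ((bilin F X₁ Y₁ ⊕ (bilin F X₁ Y₂ ⊕ bilin F X₁ Y₃))
       ⊕ ((bilin F X₂ Y₁ ⊕ (bilin F X₂ Y₂ ⊕ bilin F X₂ Y₃))
          ⊕ (bilin F X₃ Y₁ ⊕ (bilin F X₃ Y₂ ⊕ bilin F X₃ Y₃))))
  bilin-⊕₃ F X₁ X₂ X₃ Y₁ Y₂ Y₃ = begin
    bilin F (X₁ ⊕ (X₂ ⊕ X₃)) Yₛ
      ≈⟨ bilin-⊕ˡ F X₁ (X₂ ⊕ X₃) Yₛ ⟩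
    bilin F X₁ Yₛ ⊕ bilin F (X₂ ⊕ X₃) Yₛ
      ≈⟨ ∙-cong refl (bilin-⊕ˡ F X₂ X₃ Yₛ) ⟩
    bilin F X₁ Yₛ ⊕ (bilin F X₂ Yₛ ⊕ bilin F X₃ Yₛ)
      ≈⟨ ∙-cong (split X₁) (∙-cong (split X₂) (split X₃)) ⟩
    ((bilin F X₁ Y₁ ⊕ (bilin F X₁ Y₂ ⊕ bilin F X₁ Y₃))
     ⊕ ((bilin F X₂ Y₁ ⊕ (bilin F X₂ Y₂ ⊕ bilin F X₂ Y₃))
        ⊕ (bilin F X₃ Y₁ ⊕ (bilin F X₃ Y₂ ⊕ bilin F X₃ Y₃))))
      ∎
    where
    Yₛ : 𝒜⊗𝒜
    Yₛ = Y₁ ⊕ (Y₂ ⊕ Y₃)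
    split : ∀ X → bilin F X Yₛ ≐ bilin F X Y₁ ⊕ (bilin F X Y₂ ⊕ bilin F X Y₃)
    split X = begin
      bilin F X Yₛ                                   ≈⟨ bilin-⊕ʳ F X Y₁ (Y₂ ⊕ Y₃) ⟩
      bilin F X Y₁ ⊕ bilin F X (Y₂ ⊕ Y₃)            ≈⟨ ∙-cong refl (bilin-⊕ʳ F X Y₂ Y₃) ⟩
      bilin F X Y₁ ⊕ (bilin F X Y₂ ⊕ bilin F X Y₃)  ∎

  module _ (Δ : Tree → 𝒜⊗𝒜) (t s : 𝒜) (t∈𝒜⁺ : In𝒜⁺ t) (s∈𝒜⁺ : In𝒜⁺ s) where

    private
      A B C A′ B′ C′ : 𝒜⊗𝒜
      A = 𝟙 ⊗ t
      B = t ⊗ 𝟙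
      C = Δ̃ Δ t
      A′ = 𝟙 ⊗ s
      B′ = s ⊗ 𝟙
      C′ = Δ̃ Δ s

    Δ̃-expansion : ∀ {op} → Multiplicative Δ op → RespectsAugmentation op → Δ̃ Δ (bilin op t s) ≐
      ((A ⋉[ op ] B′ ⊕ A ⋉[ op ] C′)
       ⊕ ((B ⋉[ op ] A′ ⊕ B ⋉[ op ] C′) ⊕ (C ⋉[ op ] A′ ⊕ (C ⋉[ op ] B′ ⊕ C ⋉[ op ] C′))))
    Δ̃-expansion {op} mult aug = Δ̃-≐ Δ (bilin op t s) _ (begin
      linExt Δ (bilin op t s)
        ≈⟨ ≈⊗⇒≐ (linExt Δ (bilin op t s)) (linExt Δ t ⋉[ op ] linExt Δ s) (mult t s t∈𝒜⁺ s∈𝒜⁺) ⟩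
      linExt Δ t ⋉[ op ] linExt Δ s
        ≈⟨ bilin-congˡ (lift² op) (linExt Δ s) (linExt≐𝟙⊗⊕⊗𝟙⊕Δ̃ Δ t) ⟩
      (A ⊕ (B ⊕ C)) ⋉[ op ] linExt Δ s
        ≈⟨ bilin-congʳ (lift² op) (A ⊕ (B ⊕ C)) (linExt≐𝟙⊗⊕⊗𝟙⊕Δ̃ Δ s) ⟩
      (A ⊕ (B ⊕ C)) ⋉[ op ] (A′ ⊕ (B′ ⊕ C′))
        ≈⟨ bilin-⊕₃ (lift² op) A B C A′ B′ C′ ⟩
      ((A ⋉[ op ] A′ ⊕ (A ⋉[ op ] B′ ⊕ A ⋉[ op ] C′))
       ⊕ ((B ⋉[ op ] A′ ⊕ (B ⋉[ op ] B′ ⊕ B ⋉[ op ] C′))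
          ⊕ (C ⋉[ op ] A′ ⊕ (C ⋉[ op ] B′ ⊕ C ⋉[ op ] C′))))
        ≈⟨ solve 9 (λ aa ab ac ba bb bc ca cb cc →
             ((aa ⊕′ (ab ⊕′ ac)) ⊕′ ((ba ⊕′ (bb ⊕′ bc)) ⊕′ (ca ⊕′ (cb ⊕′ cc))))
             ⊜ (aa ⊕′ (bb ⊕′ ((ab ⊕′ ac) ⊕′ ((ba ⊕′ bc) ⊕′ (ca ⊕′ (cb ⊕′ cc)))))))
             refl
             (A ⋉[ op ] A′) (A ⋉[ op ] B′) (A ⋉[ op ] C′) (B ⋉[ op ] A′) (B ⋉[ op ] B′)
             (B ⋉[ op ] C′) (C ⋉[ op ] A′) (C ⋉[ op ] B′) (C ⋉[ op ] C′) ⟩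
      A ⋉[ op ] A′ ⊕ (B ⋉[ op ] B′ ⊕ _)
        ≈⟨ ∙-cong (lift²-𝟙⊗-𝟙⊗ op (RespectsAugmentation.unit-unit aug) t s)
                  (∙-cong (lift²-⊗𝟙-⊗𝟙 op t s) refl) ⟩
      (𝟙 ⊗ bilin op t s) ⊕ ((bilin op t s ⊗ 𝟙) ⊕ _)
        ∎)

    module _ (isΔ : IsCoproduct Δ) where
      open IsCoproduct isΔ

      private
        C∈𝒜⊗𝒜⁺ : In𝒜⊗𝒜⁺ C
        C∈𝒜⊗𝒜⁺ = Δ̃-In𝒜⊗𝒜⁺ Δ isΔ t t∈𝒜⁺
        C′∈𝒜⊗𝒜⁺ : In𝒜⊗𝒜⁺ C′
        C′∈𝒜⊗𝒜⁺ = Δ̃-In𝒜⊗𝒜⁺ Δ isΔ s s∈𝒜⁺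

      Δ̃-· : Δ̃ Δ (t · s) ≐ (Δ̃ Δ t ·⊗ Δ̃ Δ s) ⊕ (((𝟙 ⊗ t) ·⊗ Δ̃ Δ s) ⊕ (Δ̃ Δ t ·⊗ (𝟙 ⊗ s)))
      Δ̃-· = begin
        Δ̃ Δ (t · s)
          ≈⟨ Δ̃-expansion Δ-· ·-respectsAugmentation ⟩
        ((A ·⊗ B′) ⊕ (A ·⊗ C′)) ⊕ (((B ·⊗ A′) ⊕ (B ·⊗ C′)) ⊕ ((C ·⊗ A′) ⊕ ((C ·⊗ B′) ⊕ (C ·⊗ C′))))
          ≈⟨ ∙-cong (∙-cong A·B′≐[] (≐-refl (A ·⊗ C′)))
                    (∙-cong (∙-cong B·A′≐[] B·C′≐[])
                            (∙-cong (≐-refl (C ·⊗ A′)) (∙-cong C·B′≐[] (≐-refl (C ·⊗ C′))))) ⟩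
        ([] ⊕ (A ·⊗ C′)) ⊕ (([] ⊕ []) ⊕ ((C ·⊗ A′) ⊕ ([] ⊕ (C ·⊗ C′))))
          ≈⟨ solve 3 (λ ac ca cc →
                 (id ⊕′ ac) ⊕′ ((id ⊕′ id) ⊕′ (ca ⊕′ (id ⊕′ cc))) ⊜ cc ⊕′ (ac ⊕′ ca))
               refl (A ·⊗ C′) (C ·⊗ A′) (C ·⊗ C′) ⟩
        (C ·⊗ C′) ⊕ ((A ·⊗ C′) ⊕ (C ·⊗ A′))
          ∎
        where
        A·B′≐[] : A ·⊗ B′ ≐ []
        A·B′≐[] = trans (lift²-𝟙⊗-⊗𝟙 dotT t s t∈𝒜⁺) (⊗-zeroʳ s (·-𝟙 t))
        B·A′≐[] : B ·⊗ A′ ≐ []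
        B·A′≐[] = trans (lift²-⊗𝟙-𝟙⊗ dotT t s s∈𝒜⁺) (⊗-zeroʳ t (𝟙-· s))
        B·C′≐[] : B ·⊗ C′ ≐ []
        B·C′≐[] = lift²-⊗𝟙-In𝒜⊗𝒜⁺-vanish dotT (λ _ _ _ → ≡.refl) t C′ C′∈𝒜⊗𝒜⁺
        C·B′≐[] : C ·⊗ B′ ≐ []
        C·B′≐[] = lift²-In𝒜⊗𝒜⁺-⊗𝟙-vanish dotT (λ _ _ _ → ≡.refl) C s C∈𝒜⊗𝒜⁺

      Δ̃-≺ : Δ̃ Δ (t ≺ s) ≐
        (s ⊗ t) ⊕ (((𝟙 ⊗ t) ≺⊗ Δ̃ Δ s) ⊕ ((Δ̃ Δ t ≺⊗ (𝟙 ⊗ s)) ⊕ ((Δ̃ Δ t ✱⊗ (s ⊗ 𝟙)) ⊕ (Δ̃ Δ t ≺⊗ Δ̃ Δ s))))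
      Δ̃-≺ = begin
        Δ̃ Δ (t ≺ s)
          ≈⟨ Δ̃-expansion Δ-≺ ≺-respectsAugmentation ⟩
        ((A ≺⊗ B′) ⊕ (A ≺⊗ C′)) ⊕ (((B ≺⊗ A′) ⊕ (B ≺⊗ C′)) ⊕ ((C ≺⊗ A′) ⊕ ((C ≺⊗ B′) ⊕ (C ≺⊗ C′))))
          ≈⟨ ∙-cong (∙-cong A≺B′≐s⊗t (≐-refl (A ≺⊗ C′)))
                    (∙-cong (∙-cong B≺A′≐[] B≺C′≐[])
                            (∙-cong (≐-refl (C ≺⊗ A′)) (∙-cong C≺B′≐C✱B′ (≐-refl (C ≺⊗ C′))))) ⟩
        ((s ⊗ t) ⊕ (A ≺⊗ C′)) ⊕ (([] ⊕ []) ⊕ ((C ≺⊗ A′) ⊕ ((C ✱⊗ B′) ⊕ (C ≺⊗ C′))))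
          ≈⟨ solve 5 (λ st ac ca cb cc →
                 (st ⊕′ ac) ⊕′ ((id ⊕′ id) ⊕′ (ca ⊕′ (cb ⊕′ cc))) ⊜ st ⊕′ (ac ⊕′ (ca ⊕′ (cb ⊕′ cc))))
               refl (s ⊗ t) (A ≺⊗ C′) (C ≺⊗ A′) (C ✱⊗ B′) (C ≺⊗ C′) ⟩
        (s ⊗ t) ⊕ ((A ≺⊗ C′) ⊕ ((C ≺⊗ A′) ⊕ ((C ✱⊗ B′) ⊕ (C ≺⊗ C′))))
          ∎
        where
        A≺B′≐s⊗t : A ≺⊗ B′ ≐ s ⊗ t
        A≺B′≐s⊗t = trans (lift²-𝟙⊗-⊗𝟙 precT t s t∈𝒜⁺) (⊗-congʳ s (≺-𝟙 t t∈𝒜⁺))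
        B≺A′≐[] : B ≺⊗ A′ ≐ []
        B≺A′≐[] = trans (lift²-⊗𝟙-𝟙⊗ precT t s s∈𝒜⁺) (⊗-zeroʳ t (𝟙-≺ s))
        B≺C′≐[] : B ≺⊗ C′ ≐ []
        B≺C′≐[] = lift²-⊗𝟙-In𝒜⊗𝒜⁺-vanish precT (λ _ _ _ → ≡.refl) t C′ C′∈𝒜⊗𝒜⁺
        C≺B′≐C✱B′ : C ≺⊗ B′ ≐ C ✱⊗ B′
        C≺B′≐C✱B′ = bilin-In𝒜⊗𝒜⁺-⊗𝟙 prec² star² (λ _ _ _ _ _ _ → ≈-refl) C s C∈𝒜⊗𝒜⁺

      Δ̃-≻ : Δ̃ Δ (t ≻ s) ≐
        (t ⊗ s) ⊕ (((𝟙 ⊗ t) ≻⊗ Δ̃ Δ s) ⊕ (((t ⊗ 𝟙) ✱⊗ Δ̃ Δ s) ⊕ ((Δ̃ Δ t ≻⊗ (𝟙 ⊗ s)) ⊕ (Δ̃ Δ t ≻⊗ Δ̃ Δ s))))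
      Δ̃-≻ = begin
        Δ̃ Δ (t ≻ s)
          ≈⟨ Δ̃-expansion Δ-≻ ≻-respectsAugmentation ⟩
        ((A ≻⊗ B′) ⊕ (A ≻⊗ C′)) ⊕ (((B ≻⊗ A′) ⊕ (B ≻⊗ C′)) ⊕ ((C ≻⊗ A′) ⊕ ((C ≻⊗ B′) ⊕ (C ≻⊗ C′))))
          ≈⟨ ∙-cong (∙-cong A≻B′≐[] (≐-refl (A ≻⊗ C′)))
                    (∙-cong (∙-cong B≻A′≐t⊗s B≻C′≐B✱C′)
                            (∙-cong (≐-refl (C ≻⊗ A′)) (∙-cong C≻B′≐[] (≐-refl (C ≻⊗ C′))))) ⟩
        ([] ⊕ (A ≻⊗ C′)) ⊕ (((t ⊗ s) ⊕ (B ✱⊗ C′)) ⊕ ((C ≻⊗ A′) ⊕ ([] ⊕ (C ≻⊗ C′))))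
          ≈⟨ solve 5 (λ ts ac bc ca cc →
                 (id ⊕′ ac) ⊕′ ((ts ⊕′ bc) ⊕′ (ca ⊕′ (id ⊕′ cc))) ⊜ ts ⊕′ (ac ⊕′ (bc ⊕′ (ca ⊕′ cc))))
               refl (t ⊗ s) (A ≻⊗ C′) (B ✱⊗ C′) (C ≻⊗ A′) (C ≻⊗ C′) ⟩
        (t ⊗ s) ⊕ ((A ≻⊗ C′) ⊕ ((B ✱⊗ C′) ⊕ ((C ≻⊗ A′) ⊕ (C ≻⊗ C′))))
          ∎
        where
        A≻B′≐[] : A ≻⊗ B′ ≐ []
        A≻B′≐[] = trans (lift²-𝟙⊗-⊗𝟙 succT t s t∈𝒜⁺) (⊗-zeroʳ s (≻-𝟙 t t∈𝒜⁺))
        B≻A′≐t⊗s : B ≻⊗ A′ ≐ t ⊗ s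
        B≻A′≐t⊗s = trans (lift²-⊗𝟙-𝟙⊗ succT t s s∈𝒜⁺) (⊗-congʳ t (𝟙-≻ s))
        B≻C′≐B✱C′ : B ≻⊗ C′ ≐ B ✱⊗ C′
        B≻C′≐B✱C′ = bilin-⊗𝟙-In𝒜⊗𝒜⁺ succ² star² (λ _ _ _ _ _ _ → ≈-refl) t C′ C′∈𝒜⊗𝒜⁺
        C≻B′≐[] : C ≻⊗ B′ ≐ []
        C≻B′≐[] = lift²-In𝒜⊗𝒜⁺-⊗𝟙-vanish succT (λ _ _ _ → ≡.refl) C s C∈𝒜⊗𝒜⁺

mainTheorem5 : ∀ {c ℓ} (F : Field c ℓ) →
    let open Field F using (commutativeRing) in
    let open Lin commutativeRing in
    (Δ : Tree → 𝒜⊗𝒜) → IsCoproduct Δ →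
    (t s : 𝒜) → In𝒜⁺ t → In𝒜⁺ s →
    (Δ̃ Δ (t · s) ≈⊗
       ((Δ̃ Δ t ·⊗ Δ̃ Δ s) ⊕ (((𝟙 ⊗ t) ·⊗ Δ̃ Δ s) ⊕ (Δ̃ Δ t ·⊗ (𝟙 ⊗ s)))))
    × (Δ̃ Δ (t ≺ s) ≈⊗
       ((s ⊗ t) ⊕ (((𝟙 ⊗ t) ≺⊗ Δ̃ Δ s) ⊕ ((Δ̃ Δ t ≺⊗ (𝟙 ⊗ s))
          ⊕ ((Δ̃ Δ t ✱⊗ (s ⊗ 𝟙)) ⊕ (Δ̃ Δ t ≺⊗ Δ̃ Δ s))))))
    × (Δ̃ Δ (t ≻ s) ≈⊗
       ((t ⊗ s) ⊕ (((𝟙 ⊗ t) ≻⊗ Δ̃ Δ s) ⊕ (((t ⊗ 𝟙) ✱⊗ Δ̃ Δ s)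
          ⊕ ((Δ̃ Δ t ≻⊗ (𝟙 ⊗ s)) ⊕ (Δ̃ Δ t ≻⊗ Δ̃ Δ s))))))
mainTheorem5 F Δ isΔ t s t∈𝒜⁺ s∈𝒜⁺ =
    ≐⇒≈⊗ (Δ̃-· Δ t s t∈𝒜⁺ s∈𝒜⁺ isΔ)
  , ≐⇒≈⊗ (Δ̃-≺ Δ t s t∈𝒜⁺ s∈𝒜⁺ isΔ)
  , ≐⇒≈⊗ (Δ̃-≻ Δ t s t∈𝒜⁺ s∈𝒜⁺ isΔ)
  where
  R = Field.commutativeRing F
  open Evaluation R using (≐⇒≈⊗)
  open TensorFormulas R using (Δ̃-·; Δ̃-≺; Δ̃-≻)
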